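{- For every vertex $v$ and state $\sigma\in\Omega$, let $S'(v,\sigma)$ be the set of assignments that can be reached at the end of Step 1 of $\textsc{Recolor}(v,\sigma)$, and $S''(v,\sigma)$ the set of possible final assignments of $\textsc{Recolor}(v,\sigma)$. Then $|S'(v,\sigma)|=|S''(v,\sigma)|$.
   Context: $G=(V,E)$ is a graph with a fixed ordering of its vertices and of its edges; each vertex $v$ has a list $\mathcal L_v$ of colors; $\mathrm{Blank}$ is an additional special color. A state assigns to every vertex either a color in $\mathcal L_v\cup\{\mathrm{Blank}\}$ (the vertex is then called colored) or an edge of $G$ (the vertex is uncolored, the edge recording the reason). An edge is monochromatic if both endpoints are colored with the same non-Blank color. $\Omega$ is the set of states with no monochromatic edge. $N_v$ is the set of neighbors of $v$. For $u\in N_v$, $R_u^v(\sigma)$ is the set of colors $c\in\mathcal L_u\cup\{\mathrm{Blank}\}$ such that assigning $c$ to $u$ in $\sigma$ creates no monochromatic edge except possibly edges with both endpoints in $N_v$. Procedure $\textsc{Recolor}(v,\sigma)$: Step 1: assign to each colored vertex $u\in N_v$ a uniformly random color from $R_u^v(\sigma)$ (independently). Then, while monochromatic edges exist: let $u$ be the lowest indexed vertex participating in a monochromatic edge, let $e$ be the lowest indexed monochromatic edge with endpoint $u$, and uncolor $u$ by assigning $e$ to $u$. -}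

module Defs where

open import Data.Nat using (ℕ)
open import Data.Fin using (Fin; _<_)
open import Data.Vec using (Vec; lookup; _[_]≔_)
open import Data.List using (List)
open import Data.List.Membership.Propositional using (_∈_)
open import Data.Product using (Σ; _×_; _,_; proj₁; proj₂; ∃; ∃-syntax)
open import Data.Sum using (_⊎_)
open import Relation.Nullary using (¬_)
open import Relation.Binary.PropositionalEquality using (_≡_)
open import Relation.Binary.Construct.Closure.ReflexiveTransitive using (Star)

data Col : Set where
  blank : Col
  col   : ℕ → Col

-- A (simple) graph on vertices Fin n with edges e : Fin m (fixed orderings
-- given by the orderings of Fin n and Fin m), and color lists L v.
record ListGraph : Set where
  field
    n      : ℕ
    m      : ℕ
    edges  : Vec (Fin n × Fin n) m
    lists  : Fin n → List ℕ
    noLoop : ∀ e → ¬ (proj₁ (lookup edges e) ≡ proj₂ (lookup edges e))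
    noDup  : ∀ e f → ((proj₁ (lookup edges e) ≡ proj₁ (lookup edges f)
                        × proj₂ (lookup edges e) ≡ proj₂ (lookup edges f))
                      ⊎ (proj₁ (lookup edges e) ≡ proj₂ (lookup edges f)
                        × proj₂ (lookup edges e) ≡ proj₁ (lookup edges f)))
                     → e ≡ f

module _ (G : ListGraph) where
  open ListGraph G

  data Val : Set where
    colored   : Col → Val
    uncolored : Fin m → Val

  State : Set
  State = Vec Val n

  Colored : Val → Set
  Colored x = ∃[ c ] (x ≡ colored c)

  Allowed : Fin n → Col → Set
  Allowed v c = (c ≡ blank) ⊎ (∃[ k ] (c ≡ col k × k ∈ lists v))

  IsState : State → Set
  IsState σ = ∀ v c → lookup σ v ≡ colored c → Allowed v c

  Endpoint : Fin n → Fin m → Set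
  Endpoint u e = (proj₁ (lookup edges e) ≡ u) ⊎ (proj₂ (lookup edges e) ≡ u)

  Mono : State → Fin m → Set
  Mono σ e = ∃[ k ] (lookup σ (proj₁ (lookup edges e)) ≡ colored (col k)
                   × lookup σ (proj₂ (lookup edges e)) ≡ colored (col k))

  NoMono : State → Set
  NoMono σ = ∀ e → ¬ Mono σ e

  Ω : State → Set
  Ω σ = IsState σ × NoMono σ

  Nbr : Fin n → Fin n → Set
  Nbr v u = ∃[ e ] ((proj₁ (lookup edges e) ≡ v × proj₂ (lookup edges e) ≡ u)
                  ⊎ (proj₁ (lookup edges e) ≡ u × proj₂ (lookup edges e) ≡ v))

  R : Fin n → State → Fin n → Col → Set
  R v σ u c = Allowed u c
            × (∀ e → Mono (σ [ u ]≔ colored c) e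
                   → Nbr v (proj₁ (lookup edges e)) × Nbr v (proj₂ (lookup edges e)))

  Step1 : Fin n → State → State → Set
  Step1 v σ τ = ∀ u →
      (Nbr v u × Colored (lookup σ u) × ∃[ c ] (R v σ u c × lookup τ u ≡ colored c))
    ⊎ (¬ (Nbr v u × Colored (lookup σ u)) × lookup τ u ≡ lookup σ u)

  UncolorStep : State → State → Set
  UncolorStep τ τ' = ∃[ u ] ∃[ e ]
      ( Mono τ e × Endpoint u e
      × (∀ u' → u' < u → ∀ e' → Endpoint u' e' → ¬ Mono τ e')
      × (∀ e' → e' < e → Endpoint u e' → ¬ Mono τ e')
      × τ' ≡ τ [ u ]≔ uncolored e )

  S′ : Fin n → State → State → Set
  S′ v σ τ = Step1 v σ τ

  S″ : Fin n → State → State → Set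
  S″ v σ ρ = ∃[ τ ] (Step1 v σ τ × Star UncolorStep τ ρ × NoMono ρ)

SameCard : {A : Set} → (A → Set) → (A → Set) → Set
SameCard {A} P Q =
  Σ (Σ A P → Σ A Q) λ f →
      (∀ x y → proj₁ (f x) ≡ proj₁ (f y) → proj₁ x ≡ proj₁ y)
    × (∀ b → Q b → ∃[ a ] (proj₁ (f a) ≡ b))

module Submission where

-- The loop is a deterministic transition system ('UncolorStep') whose every step
-- uncolors one colored vertex.  Hence from each τ there is exactly one terminal
-- run: it exists because the number of colored vertices decreases, and it is
-- unique because each state has at most one successor.  This gives a well-defined
-- surjective map from Step-1 outcomes to final outcomes.
--
-- Injectivity is the real content.  During the loop colors are never created, and
-- a vertex u uncolored with reason e was, at that moment, colored like the other
-- endpoint w of e, with u < w (u is the least vertex on a monochromatic edge).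
-- So the final state ρ determines τ(u) from τ(w); two Step-1 outcomes with the
-- same final state therefore agree on every vertex, by induction downwards along
-- the vertex order.  This uses only that the two outcomes agree off the vertices
-- recolored in Step 1 ('AgreeOffColored'), which holds for any two outcomes of
-- Step 1 from the same σ.

open import Defs
open import Data.Fin using (Fin; zero; suc; _<_; _>_; _≟_)
open import Data.Fin.Properties using (any?; <-cmp)
open import Data.Fin.Induction using (>-wellFounded)
open import Data.Nat as ℕ using (ℕ; s≤s)
open import Data.Nat.Properties using (≤-refl)
open import Data.Nat.Induction using (<-wellFounded)
open import Data.Vec using (Vec; []; _∷_; lookup; _[_]≔_)
open import Data.Vec.Properties using (lookup∘update; lookup∘update′)
open import Data.Vec.Relation.Binary.Pointwise.Extensional using (ext; Pointwise-≡⇒≡)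
open import Data.Product using (Σ; _×_; _,_; proj₁; proj₂; ∃)
open import Data.Sum using (_⊎_; inj₁; inj₂)
open import Data.Empty using (⊥-elim)
open import Relation.Nullary using (¬_; Dec; yes; no)
open import Relation.Nullary.Decidable using (_⊎-dec_; _×-dec_)
open import Relation.Unary using (Decidable)
open import Relation.Binary using (tri<; tri≈; tri>)
open import Relation.Binary.PropositionalEquality
  using (_≡_; _≢_; refl; sym; trans; cong; subst; module ≡-Reasoning)
open import Relation.Binary.Construct.Closure.ReflexiveTransitive using (Star; ε; _◅_)
open import Induction.WellFounded using (Acc; acc)

leastWitness : ∀ {n} (P : Fin n → Set) → Decidable P → ∃ P →
               ∃ λ i → P i × (∀ j → j < i → ¬ P j)
leastWitness {ℕ.zero} P P? (() , _)
leastWitness {ℕ.suc n} P P? (i , pi) with P? zero | i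
... | yes p0 | _ = zero , p0 , λ _ ()
... | no ¬p0 | zero = ⊥-elim (¬p0 pi)
... | no ¬p0 | suc i′ with leastWitness (λ k → P (suc k)) (λ k → P? (suc k)) (i′ , pi)
...   | k , pk , below-k = suc k , pk , below
  where
  below : ∀ j → j < suc k → ¬ P j
  below zero    _        = ¬p0
  below (suc j) (s≤s lt) = below-k j lt

lookup-update-cases : ∀ {A : Set} {k} (xs : Vec A k) (i j : Fin k) (x y : A) →
                      lookup (xs [ j ]≔ x) i ≡ y → (i ≡ j × x ≡ y) ⊎ (lookup xs i ≡ y)
lookup-update-cases xs i j x y eq with i ≟ j
... | yes refl = inj₁ (refl , trans (sym (lookup∘update i xs x)) eq)
... | no i≢j   = inj₂ (trans (sym (lookup∘update′ i≢j xs x)) eq)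

module _ (G : ListGraph) where
  open ListGraph G

  Joins : Fin m → Fin n → Fin n → Set
  Joins e u w = (proj₁ (lookup edges e) ≡ u × proj₂ (lookup edges e) ≡ w)
              ⊎ (proj₁ (lookup edges e) ≡ w × proj₂ (lookup edges e) ≡ u)

  SameColor : State G → Fin n → Fin n → Set
  SameColor τ u w = ∃ λ c → lookup τ u ≡ colored c × lookup τ w ≡ colored c

  colored≢uncolored : ∀ {x : Val G} {c e} → x ≡ colored c → x ≢ uncolored e
  colored≢uncolored refl ()

  otherEnd : ∀ {u e} → Endpoint G u e → ∃ (Joins e u)
  otherEnd (inj₁ p) = proj₂ (lookup edges _) , inj₁ (p , refl)
  otherEnd (inj₂ p) = proj₁ (lookup edges _) , inj₂ (refl , p)

  joins-endpoint : ∀ {e u w} → Joins e u w → Endpoint G w e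
  joins-endpoint (inj₁ (_ , p)) = inj₂ p
  joins-endpoint (inj₂ (p , _)) = inj₁ p

  joins-distinct : ∀ {e u w} → Joins e u w → u ≢ w
  joins-distinct {e} (inj₁ (a , b)) u≡w = noLoop e (trans a (trans u≡w (sym b)))
  joins-distinct {e} (inj₂ (a , b)) u≡w = noLoop e (trans a (trans (sym u≡w) (sym b)))

  joins-unique : ∀ {e u w₁ w₂} → Joins e u w₁ → Joins e u w₂ → w₁ ≡ w₂
  joins-unique     (inj₁ (_ , b)) (inj₁ (_ , b′)) = trans (sym b) b′
  joins-unique     (inj₂ (a , _)) (inj₂ (a′ , _)) = trans (sym a) a′
  joins-unique {e} (inj₁ (a , _)) (inj₂ (_ , b′)) = ⊥-elim (noLoop e (trans a (sym b′)))
  joins-unique {e} (inj₂ (_ , b)) (inj₁ (a′ , _)) = ⊥-elim (noLoop e (trans a′ (sym b)))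

  mono-sameColor : ∀ {τ e u w} → Mono G τ e → Joins e u w → SameColor τ u w
  mono-sameColor (k , p , q) (inj₁ (refl , refl)) = col k , p , q
  mono-sameColor (k , p , q) (inj₂ (refl , refl)) = col k , q , p

  bothColor? : (x y : Val G) → Dec (∃ λ k → x ≡ colored (col k) × y ≡ colored (col k))
  bothColor? (colored (col k)) (colored (col k′)) with k ℕ.≟ k′
  ... | yes refl = yes (k , refl , refl)
  ... | no k≢k′  = no λ { (_ , refl , refl) → k≢k′ refl }
  bothColor? (colored (col k)) (colored blank)  = no λ { (_ , _ , ()) }
  bothColor? (colored (col k)) (uncolored _)    = no λ { (_ , _ , ()) }
  bothColor? (colored blank)   _                = no λ { (_ , () , _) }
  bothColor? (uncolored _)     _                = no λ { (_ , () , _) }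

  mono? : ∀ τ → Decidable (Mono G τ)
  mono? τ e = bothColor? (lookup τ (proj₁ (lookup edges e))) (lookup τ (proj₂ (lookup edges e)))

  endpoint? : ∀ u e → Dec (Endpoint G u e)
  endpoint? u e = (proj₁ (lookup edges e) ≟ u) ⊎-dec (proj₂ (lookup edges e) ≟ u)

  coloredCount : ∀ {k} → Vec (Val G) k → ℕ
  coloredCount []                = 0
  coloredCount (colored _ ∷ xs)   = ℕ.suc (coloredCount xs)
  coloredCount (uncolored _ ∷ xs) = coloredCount xs

  coloredCount-uncolor : ∀ {k} (xs : Vec (Val G) k) i {c} e → lookup xs i ≡ colored c →
                         coloredCount (xs [ i ]≔ uncolored e) ℕ.< coloredCount xs
  coloredCount-uncolor (colored _ ∷ xs)   zero    e refl = ≤-refl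
  coloredCount-uncolor (colored _ ∷ xs)   (suc i) e p    = s≤s (coloredCount-uncolor xs i e p)
  coloredCount-uncolor (uncolored _ ∷ xs) (suc i) e p    = coloredCount-uncolor xs i e p

  uncolorStep-exists : ∀ {τ} → ∃ (Mono G τ) → ∃ (UncolorStep G τ)
  uncolorStep-exists {τ} (e , mono)
    with leastWitness (λ u → ∃ λ e → Endpoint G u e × Mono G τ e)
                      (λ u → any? (λ e → endpoint? u e ×-dec mono? τ e))
                      (proj₁ (lookup edges e) , e , inj₁ refl , mono)
  ... | u , (e₁ , end₁ , mono₁) , u-least
    with leastWitness (λ e → Endpoint G u e × Mono G τ e)
                      (λ e → endpoint? u e ×-dec mono? τ e) (e₁ , end₁ , mono₁)
  ... | e₀ , (end₀ , mono₀) , e-least =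
    τ [ u ]≔ uncolored e₀ ,
    u , e₀ , mono₀ , end₀ ,
    (λ u′ lt e′ end′ mono′ → u-least u′ lt (e′ , end′ , mono′)) ,
    (λ e′ lt end′ mono′ → e-least e′ lt (end′ , mono′)) ,
    refl

  -- The uncolored vertex lies on a monochromatic edge, so it was colored.
  uncolorStep-decreases : ∀ {τ τ′} → UncolorStep G τ τ′ → coloredCount τ′ ℕ.< coloredCount τ
  uncolorStep-decreases {τ} (u , e , mono , end , _ , _ , refl) =
    let _ , p , _ = mono-sameColor {τ} mono (proj₂ (otherEnd end))
    in coloredCount-uncolor τ u e p

  -- The loop is deterministic: the uncolored vertex and its reason are both
  -- forced by minimality.
  uncolorStep-deterministic : ∀ {τ τ₁ τ₂} → UncolorStep G τ τ₁ → UncolorStep G τ τ₂ → τ₁ ≡ τ₂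
  uncolorStep-deterministic (u₁ , e₁ , m₁ , end₁ , u₁-least , e₁-least , refl)
                            (u₂ , e₂ , m₂ , end₂ , u₂-least , e₂-least , refl)
    with <-cmp u₁ u₂
  ... | tri< lt _ _ = ⊥-elim (u₂-least u₁ lt e₁ end₁ m₁)
  ... | tri> _ _ gt = ⊥-elim (u₁-least u₂ gt e₂ end₂ m₂)
  ... | tri≈ _ refl _ with <-cmp e₁ e₂
  ...   | tri< lt _ _ = ⊥-elim (e₂-least e₁ lt end₁ m₁)
  ...   | tri> _ _ gt = ⊥-elim (e₁-least e₂ gt end₂ m₂)
  ...   | tri≈ _ refl _ = refl

  Outcome : State G → Set
  Outcome τ = Σ (State G) λ ρ → Star (UncolorStep G) τ ρ × NoMono G ρ

  outcome-exists : ∀ τ → Outcome τ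
  outcome-exists τ = go τ (<-wellFounded (coloredCount τ))
    where
    go : ∀ τ → Acc ℕ._<_ (coloredCount τ) → Outcome τ
    go τ (acc smaller) with any? (mono? τ)
    ... | no none = τ , ε , λ e mono → none (e , mono)
    ... | yes some with uncolorStep-exists some
    ...   | τ′ , step with go τ′ (smaller (uncolorStep-decreases step))
    ...     | ρ , run , final = ρ , step ◅ run , final

  step-needs-mono : ∀ {τ τ′} → UncolorStep G τ τ′ → ¬ NoMono G τ
  step-needs-mono (_ , e , mono , _) final = final e mono

  -- Determinism makes the terminal state reached from τ unique.
  outcome-unique : ∀ {τ ρ₁ ρ₂} → Star (UncolorStep G) τ ρ₁ → NoMono G ρ₁ →
                   Star (UncolorStep G) τ ρ₂ → NoMono G ρ₂ → ρ₁ ≡ ρ₂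
  outcome-unique ε         _  ε         _  = refl
  outcome-unique ε         f₁ (s ◅ _)   _  = ⊥-elim (step-needs-mono s f₁)
  outcome-unique (s ◅ _)   _  ε         f₂ = ⊥-elim (step-needs-mono s f₂)
  outcome-unique (s₁ ◅ r₁) f₁ (s₂ ◅ r₂) f₂ with uncolorStep-deterministic s₁ s₂
  ... | refl = outcome-unique r₁ f₁ r₂ f₂

  step-keeps-colors : ∀ {τ τ′} → UncolorStep G τ τ′ → ∀ {u c} →
                      lookup τ′ u ≡ colored c → lookup τ u ≡ colored c
  step-keeps-colors {τ} (u₀ , e₀ , _ , _ , _ , _ , refl) {u} {c} eq
    with lookup-update-cases τ u u₀ (uncolored e₀) (colored c) eq
  ... | inj₁ (_ , ())
  ... | inj₂ old = old

  run-keeps-colors : ∀ {τ ρ} → Star (UncolorStep G) τ ρ → ∀ {u c} →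
                     lookup ρ u ≡ colored c → lookup τ u ≡ colored c
  run-keeps-colors ε       eq = eq
  run-keeps-colors (s ◅ r) eq = step-keeps-colors s (run-keeps-colors r eq)

  -- Why u ends up uncolored with reason e: either it already was, or e joins u
  -- to a higher vertex w which had the same color as u when u got uncolored.
  UncoloredBy : State G → Fin n → Fin m → Set
  UncoloredBy τ u e = lookup τ u ≡ uncolored e
                    ⊎ (∃ λ w → u < w × Joins e u w × SameColor τ u w)

  step-reason : ∀ {τ τ′} → UncolorStep G τ τ′ → ∀ {u e} →
                lookup τ′ u ≡ uncolored e → UncoloredBy τ u e
  step-reason {τ} (u₀ , e₀ , mono , end , u₀-least , _ , refl) {u} {e} eq
    with lookup-update-cases τ u u₀ (uncolored e₀) (uncolored e) eq
  ... | inj₂ old = inj₁ old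
  ... | inj₁ (refl , refl) with otherEnd end
  ...   | w , joins with <-cmp u w
  ...     | tri< lt _ _ = inj₂ (w , lt , joins , mono-sameColor {τ} mono joins)
  ...     | tri≈ _ u≡w _ = ⊥-elim (joins-distinct joins u≡w)
  ...     | tri> _ _ gt = ⊥-elim (u₀-least w gt e (joins-endpoint joins) mono)

  run-reason : ∀ {τ ρ} → Star (UncolorStep G) τ ρ → ∀ {u e} →
               lookup ρ u ≡ uncolored e → UncoloredBy τ u e
  run-reason ε eq = inj₁ eq
  run-reason (s ◅ r) eq with run-reason r eq
  ... | inj₁ old = step-reason s old
  ... | inj₂ (w , lt , joins , c , p , q) =
          inj₂ (w , lt , joins , c , step-keeps-colors s p , step-keeps-colors s q)

  AgreeOffColored : State G → State G → Set
  AgreeOffColored τ₁ τ₂ =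
    ∀ u → lookup τ₁ u ≡ lookup τ₂ u ⊎ (Colored G (lookup τ₁ u) × Colored G (lookup τ₂ u))

  -- Step 1 only recolors the colored neighbours of v, so any two of its outcomes
  -- agree elsewhere.
  step1-agree : ∀ {v σ τ₁ τ₂} → Step1 G v σ τ₁ → Step1 G v σ τ₂ → AgreeOffColored τ₁ τ₂
  step1-agree st₁ st₂ u with st₁ u | st₂ u
  ... | inj₂ (_ , p) | inj₂ (_ , q) = inj₁ (trans p (sym q))
  ... | inj₁ (nbr , wasColored , _) | inj₂ (kept , _) = ⊥-elim (kept (nbr , wasColored))
  ... | inj₂ (kept , _) | inj₁ (nbr , wasColored , _) = ⊥-elim (kept (nbr , wasColored))
  ... | inj₁ (_ , _ , c₁ , _ , p₁) | inj₁ (_ , _ , c₂ , _ , p₂) = inj₂ ((c₁ , p₁) , (c₂ , p₂))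

  runs-injective : ∀ {τ₁ τ₂ ρ} → AgreeOffColored τ₁ τ₂ →
                   Star (UncolorStep G) τ₁ ρ → Star (UncolorStep G) τ₂ ρ → τ₁ ≡ τ₂
  runs-injective {τ₁} {τ₂} {ρ} agree r₁ r₂ =
    Pointwise-≡⇒≡ (ext λ u → agree-at u (>-wellFounded u))
    where
    open ≡-Reasoning
    agree-at : ∀ u → Acc _>_ u → lookup τ₁ u ≡ lookup τ₂ u
    agree-at u (acc higher) with agree u
    ... | inj₁ same = same
    ... | inj₂ ((_ , p₁) , (_ , p₂)) with lookup ρ u in final
    ...   | colored d = trans (run-keeps-colors r₁ final) (sym (run-keeps-colors r₂ final))
    ...   | uncolored e with run-reason r₁ final | run-reason r₂ final
    ...     | inj₁ old | _        = ⊥-elim (colored≢uncolored p₁ old)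
    ...     | inj₂ _   | inj₁ old = ⊥-elim (colored≢uncolored p₂ old)
    ...     | inj₂ (w₁ , u<w₁ , j₁ , d₁ , a₁ , b₁) | inj₂ (w₂ , _ , j₂ , d₂ , a₂ , b₂) =
      begin
        lookup τ₁ u  ≡⟨ trans a₁ (sym b₁) ⟩
        lookup τ₁ w₁ ≡⟨ agree-at w₁ (higher u<w₁) ⟩
        lookup τ₂ w₁ ≡⟨ cong (lookup τ₂) (joins-unique j₁ j₂) ⟩
        lookup τ₂ w₂ ≡⟨ trans b₂ (sym a₂) ⟩
        lookup τ₂ u  ∎

lemma4p2 : (G : ListGraph) (v : Fin (ListGraph.n G)) (σ : State G) →
    Ω G σ → SameCard (S′ G v σ) (S″ G v σ)
lemma4p2 G v σ _ = finish , injective , surjective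
  where
  finish : Σ (State G) (S′ G v σ) → Σ (State G) (S″ G v σ)
  finish (τ , st) = let ρ , run , final = outcome-exists G τ in ρ , τ , st , run , final

  injective : ∀ x y → proj₁ (finish x) ≡ proj₁ (finish y) → proj₁ x ≡ proj₁ y
  injective (τ₁ , st₁) (τ₂ , st₂) same =
    runs-injective G (step1-agree G {v} {σ} {τ₁} {τ₂} st₁ st₂)
      (proj₁ (proj₂ (outcome-exists G τ₁)))
      (subst (Star (UncolorStep G) τ₂) (sym same) (proj₁ (proj₂ (outcome-exists G τ₂))))

  surjective : ∀ ρ → S″ G v σ ρ → ∃ λ x → proj₁ (finish x) ≡ ρ
  surjective ρ (τ , st , run , final) =
    (τ , st) , outcome-unique G (proj₁ (proj₂ (outcome-exists G τ)))
                                (proj₂ (proj₂ (outcome-exists G τ))) run final
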